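{- For a niche-realizable graph $G$, the size of a maximum matching of $G$ is at least $\frac{|V(G)|-4}{2}$.
   Context: All graphs are simple. A bipartite tournament is an orientation of a complete bipartite graph. The niche graph of a digraph $D$ is the graph with vertex set $V(D)$ in which distinct $u,v$ are adjacent iff there is a vertex $w$ with $(u,w),(v,w)\in A(D)$, or with $(w,u),(w,v)\in A(D)$. A graph is niche-realizable if it is the niche graph of some bipartite tournament. -}

module Defs where

open import Data.Nat using (ℕ; _≤_; _*_; _+_)
open import Data.Fin using (Fin)
open import Data.Bool using (Bool; true; false)
open import Data.Product using (Σ; ∃; ∃-syntax; _×_; _,_)
open import Data.Sum using (_⊎_)
open import Data.List using (List; []; _∷_; length; concatMap)
open import Data.List.Relation.Unary.All using (All)
open import Data.List.Relation.Unary.Unique.Propositional using (Unique)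
open import Relation.Binary.PropositionalEquality using (_≡_; _≢_)
open import Relation.Nullary using (¬_)
open import Function.Bundles using (_⇔_)

record Graph (n : ℕ) : Set₁ where
  field
    Adj       : Fin n → Fin n → Set
    Adj-sym   : ∀ {u v} → Adj u v → Adj v u
    Adj-irrefl : ∀ {u} → ¬ Adj u u
open Graph public

Digraph : ℕ → Set₁
Digraph n = Fin n → Fin n → Set

record IsBipartiteTournament {n : ℕ} (D : Digraph n) : Set where
  field
    side       : Fin n → Bool
    X-nonempty : ∃[ x ] side x ≡ true
    Y-nonempty : ∃[ y ] side y ≡ false
    no-arc-same : ∀ u v → side u ≡ side v → ¬ D u v
    arc-cross  : ∀ u v → side u ≢ side v → D u v ⊎ D v u
    no-both    : ∀ u v → D u v → ¬ D v u

NicheAdj : ∀ {n} → Digraph n → Fin n → Fin n → Set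
NicheAdj D u v = u ≢ v × ∃[ w ] ((D u w × D v w) ⊎ (D w u × D w v))

IsNicheGraphOf : ∀ {n} → Graph n → Digraph n → Set
IsNicheGraphOf G D = ∀ u v → Adj G u v ⇔ NicheAdj D u v

NicheRealizable : ∀ {n} → Graph n → Set₁
NicheRealizable {n} G = ∃[ D ] (IsBipartiteTournament {n} D × IsNicheGraphOf G D)

endpoints : ∀ {n} → Fin n × Fin n → List (Fin n)
endpoints (u , v) = u ∷ v ∷ []

IsMatching : ∀ {n} → Graph n → List (Fin n × Fin n) → Set
IsMatching G M = All (λ e → Adj G (Data.Product.proj₁ e) (Data.Product.proj₂ e)) M
               × Unique (concatMap endpoints M)

-- Fix a vertex w in the other part. Each of three vertices of one part is
-- either an in- or an out-neighbour of w, so two of them share w as a common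
-- out- or in-neighbour and are adjacent in the niche graph. Hence no part
-- contains an independent set of size three, and greedily matching within
-- each part leaves at most two of its vertices unmatched, four in total.
module Submission where

open import Defs
open import Data.Nat using (ℕ; _≤_; _*_; _+_; suc; s≤s; z≤n)
open import Data.Nat.Properties using (*-suc; +-comm; +-mono-≤; +-monoˡ-≤; ≤-trans; ≤-reflexive; module ≤-Reasoning)
open import Data.Bool using (Bool; true; false)
open import Data.Bool.Properties using (_≟_)
open import Data.Fin using (Fin)
open import Data.Product using (Σ; _×_; ∃-syntax; _,_; proj₁; proj₂)
open import Data.Sum as Sum using (_⊎_; inj₁; inj₂)
open import Data.List using (List; []; _∷_; _++_; length; concatMap; allFin; filter)
open import Data.List.Properties using (length-++; length-tabulate)
open import Data.List.Relation.Unary.All using (All; []; _∷_)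
open import Data.List.Relation.Unary.All.Properties as All using (all-filter)
open import Data.List.Relation.Unary.AllPairs using (_∷_)
open import Data.List.Relation.Unary.Unique.Propositional using (Unique)
open import Data.List.Relation.Unary.Unique.Propositional.Properties as Unique using (allFin⁺)
open import Data.List.Relation.Binary.Permutation.Propositional
open import Data.List.Relation.Binary.Permutation.Propositional.Properties
  using (All-resp-↭; ↭-length; ++⁺ˡ; ++⁺ʳ; ++-assoc; shift; shifts)
import Data.List.Relation.Binary.Permutation.Setoid.Properties as Permutationₛ
open import Relation.Binary.PropositionalEquality using (_≡_; _≢_; refl; sym; cong; setoid; module ≡-Reasoning)
  renaming (trans to ≡-trans)
open import Relation.Nullary using (contradiction)
open import Function.Bundles using (Equivalence)

private
  variable
    A : Set
    n : ℕ

Unique-resp-↭ : {xs ys : List A} → xs ↭ ys → Unique xs → Unique ys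
Unique-resp-↭ {A = A} p = Permutationₛ.Unique-resp-↭ (setoid A) (↭⇒↭ₛ p)

Unique-++⁻ʳ : (xs : List A) {ys : List A} → Unique (xs ++ ys) → Unique ys
Unique-++⁻ʳ []       u       = u
Unique-++⁻ʳ (x ∷ xs) (_ ∷ u) = Unique-++⁻ʳ xs u

filter-bool-↭ : (f : A → Bool) (xs : List A) →
                filter (λ v → f v ≟ true) xs ++ filter (λ v → f v ≟ false) xs ↭ xs
filter-bool-↭ f [] = refl
filter-bool-↭ f (x ∷ xs) with f x
... | true  = prep x (filter-bool-↭ f xs)
... | false = trans (shift x _ _) (prep x (filter-bool-↭ f xs))

Agree : (P Q : A → Set) → A → A → Set
Agree P Q u v = (P u × P v) ⊎ (Q u × Q v)

two-of-three-agree : {P Q : A → Set} {x y z : A} → P x ⊎ Q x → P y ⊎ Q y → P z ⊎ Q z →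
                     Agree P Q x y ⊎ Agree P Q x z ⊎ Agree P Q y z
two-of-three-agree (inj₁ px) (inj₁ py) _         = inj₁ (inj₁ (px , py))
two-of-three-agree (inj₂ qx) (inj₂ qy) _         = inj₁ (inj₂ (qx , qy))
two-of-three-agree (inj₁ px) (inj₂ qy) (inj₁ pz) = inj₂ (inj₁ (inj₁ (px , pz)))
two-of-three-agree (inj₁ px) (inj₂ qy) (inj₂ qz) = inj₂ (inj₂ (inj₂ (qy , qz)))
two-of-three-agree (inj₂ qx) (inj₁ py) (inj₁ pz) = inj₂ (inj₂ (inj₁ (py , pz)))
two-of-three-agree (inj₂ qx) (inj₁ py) (inj₂ qz) = inj₂ (inj₁ (inj₂ (qx , qz)))

Edge : Graph n → Fin n × Fin n → Set
Edge G (u , v) = Adj G u v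

covered : List (Fin n × Fin n) → List (Fin n)
covered = concatMap endpoints

length-covered : (M : List (Fin n × Fin n)) → length (covered M) ≡ 2 * length M
length-covered []      = refl
length-covered (_ ∷ M) = ≡-trans (cong (λ k → suc (suc k)) (length-covered M)) (sym (*-suc 2 (length M)))

covered-++ : (M N : List (Fin n × Fin n)) → covered (M ++ N) ≡ covered M ++ covered N
covered-++ []            N = refl
covered-++ ((u , v) ∷ M) N = cong (λ vs → u ∷ v ∷ vs) (covered-++ M N)

record PartialMatching (G : Graph n) (xs : List (Fin n)) : Set where
  field
    edges     : List (Fin n × Fin n)
    unmatched : List (Fin n)
    edges-adj : All (Edge G) edges
    partition : unmatched ++ covered edges ↭ xs

module _ {G : Graph n} where
  open PartialMatching

  PartialMatching-resp-↭ : {xs ys : List (Fin n)} → xs ↭ ys → PartialMatching G xs → PartialMatching G ys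
  PartialMatching-resp-↭ p m = record
    { edges = edges m ; unmatched = unmatched m ; edges-adj = edges-adj m ; partition = trans (partition m) p }

  _++ᴹ_ : {xs ys : List (Fin n)} → PartialMatching G xs → PartialMatching G ys → PartialMatching G (xs ++ ys)
  _++ᴹ_ {xs} {ys} m m′ = record
    { edges     = edges m ++ edges m′
    ; unmatched = unmatched m ++ unmatched m′
    ; edges-adj = All.++⁺ (edges-adj m) (edges-adj m′)
    ; partition = begin
        (r ++ r′) ++ covered (edges m ++ edges m′) ≡⟨ cong ((r ++ r′) ++_) (covered-++ (edges m) (edges m′)) ⟩
        (r ++ r′) ++ (c ++ c′)                     ↭⟨ ++-assoc r r′ (c ++ c′) ⟩
        r ++ (r′ ++ c ++ c′)                       ↭⟨ ++⁺ˡ r (shifts r′ c) ⟩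
        r ++ (c ++ r′ ++ c′)                       ↭⟨ ↭-sym (++-assoc r c (r′ ++ c′)) ⟩
        (r ++ c) ++ (r′ ++ c′)                     ↭⟨ ++⁺ʳ (r′ ++ c′) (partition m) ⟩
        xs ++ (r′ ++ c′)                           ↭⟨ ++⁺ˡ xs (partition m′) ⟩
        xs ++ ys                                   ∎
    }
    where
    open PermutationReasoning
    r = unmatched m ; r′ = unmatched m′ ; c = covered (edges m) ; c′ = covered (edges m′)

  isMatching : {xs : List (Fin n)} (m : PartialMatching G xs) → Unique xs → IsMatching G (edges m)
  isMatching m u = edges-adj m , Unique-++⁻ʳ (unmatched m) (Unique-resp-↭ (↭-sym (partition m)) u)

  length-partition : {xs : List (Fin n)} (m : PartialMatching G xs) →
                     length xs ≡ length (unmatched m) + 2 * length (edges m)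
  length-partition {xs} m = begin
    length xs                                               ≡⟨ sym (↭-length (partition m)) ⟩
    length (unmatched m ++ covered (edges m))               ≡⟨ length-++ (unmatched m) ⟩
    length (unmatched m) + length (covered (edges m))       ≡⟨ cong (length (unmatched m) +_) (length-covered (edges m)) ⟩
    length (unmatched m) + 2 * length (edges m)             ∎
    where open ≡-Reasoning

  large-matching : (k : ℕ) (m : PartialMatching G (allFin n)) → length (unmatched m) ≤ k →
                   ∃[ M ] (IsMatching G M × n ≤ 2 * length M + k)
  large-matching k m unmatched≤k = edges m , isMatching m (allFin⁺ n) , (begin
    n                                           ≡⟨ length-tabulate {A = Fin n} (λ i → i) ⟨
    length (allFin n)                           ≡⟨ length-partition m ⟩
    length (unmatched m) + 2 * length (edges m) ≤⟨ +-monoˡ-≤ (2 * length (edges m)) unmatched≤k ⟩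
    k + 2 * length (edges m)                    ≡⟨ +-comm k _ ⟩
    2 * length (edges m) + k                    ∎)
    where open ≤-Reasoning

NoIndependentTriple : Graph n → (Fin n → Set) → Set
NoIndependentTriple G P = ∀ {x y z} → P x → P y → P z → x ≢ y → x ≢ z → y ≢ z →
                          Adj G x y ⊎ Adj G x z ⊎ Adj G y z

module _ {G : Graph n} {P : Fin n → Set} (no-triple : NoIndependentTriple G P) where

  edge-in-triple : {x a b : Fin n} → Adj G x a ⊎ Adj G x b ⊎ Adj G a b →
                   ∃[ c ] ∃[ e ] Edge G e × (c ∷ endpoints e ↭ x ∷ a ∷ b ∷ [])
  edge-in-triple {x} {a} {b} (inj₁ xa)        = b , (x , a) , xa , trans (swap b x refl) (prep x (swap b a refl))
  edge-in-triple {x} {a} {b} (inj₂ (inj₁ xb)) = a , (x , b) , xb , swap a x refl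
  edge-in-triple {x} {a} {b} (inj₂ (inj₂ ab)) = x , (a , b) , ab , refl

  greedy-matching : (xs : List (Fin n)) → Unique xs → All P xs →
                    Σ (PartialMatching G xs) λ m → length (PartialMatching.unmatched m) ≤ 2
  greedy-matching []       _              _          =
    record { edges = [] ; unmatched = [] ; edges-adj = [] ; partition = refl } , z≤n
  greedy-matching (x ∷ xs) u@(_ ∷ u-xs) (px ∷ pxs) with greedy-matching xs u-xs pxs
  ... | record { edges = M ; unmatched = [] ; edges-adj = adj ; partition = p } , _ =
    record { edges = M ; unmatched = x ∷ [] ; edges-adj = adj ; partition = prep x p } , s≤s z≤n
  ... | record { edges = M ; unmatched = a ∷ [] ; edges-adj = adj ; partition = p } , _ =
    record { edges = M ; unmatched = x ∷ a ∷ [] ; edges-adj = adj ; partition = prep x p } , s≤s (s≤s z≤n)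
  ... | record { unmatched = _ ∷ _ ∷ _ ∷ _ } , s≤s (s≤s ())
  ... | record { edges = M ; unmatched = a ∷ b ∷ [] ; edges-adj = adj ; partition = p } , _
    with Unique-resp-↭ (↭-sym (prep x p)) u | All-resp-↭ (↭-sym p) pxs
  ... | (x≢a ∷ x≢b ∷ _) ∷ (a≢b ∷ _) ∷ _ | pa ∷ pb ∷ _
    with edge-in-triple (no-triple px pa pb x≢a x≢b a≢b)
  ... | c , e , e-adj , triple =
    record { edges = e ∷ M ; unmatched = c ∷ [] ; edges-adj = e-adj ∷ adj
           ; partition = trans (++⁺ʳ (covered M) triple) (prep x p) } , s≤s z≤n

module _ {D : Digraph n} {G : Graph n} (bt : IsBipartiteTournament D) (niche : IsNicheGraphOf G D) where
  open IsBipartiteTournament bt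

  vertex-not-on-side : (s : Bool) → ∃[ w ] side w ≢ s
  vertex-not-on-side true  with Y-nonempty
  ... | y , sy = y , λ sy′ → contradiction (≡-trans (sym sy′) sy) λ ()
  vertex-not-on-side false with X-nonempty
  ... | x , sx = x , λ sx′ → contradiction (≡-trans (sym sx′) sx) λ ()

  adjacent-if-agree : (w : Fin n) {u v : Fin n} → u ≢ v → Agree (λ t → D t w) (λ t → D w t) u v → Adj G u v
  adjacent-if-agree w u≢v agree = Equivalence.from (niche _ _) (u≢v , w , agree)

  side-noIndependentTriple : (s : Bool) → NoIndependentTriple G (λ v → side v ≡ s)
  side-noIndependentTriple s sx sy sz x≢y x≢z y≢z with vertex-not-on-side s
  ... | w , w≢s =
    Sum.map (adjacent-if-agree w x≢y) (Sum.map (adjacent-if-agree w x≢z) (adjacent-if-agree w y≢z))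
      (two-of-three-agree {P = λ t → D t w} {Q = λ t → D w t} (arc-with sx) (arc-with sy) (arc-with sz))
    where
    arc-with : {v : Fin n} → side v ≡ s → D v w ⊎ D w v
    arc-with {v} sv = arc-cross v w λ sv≡sw → w≢s (≡-trans (sym sv≡sw) sv)

  side-partialMatching : (s : Bool) → Σ (PartialMatching G (filter (λ v → side v ≟ s) (allFin n)))
                                        λ m → length (PartialMatching.unmatched m) ≤ 2
  side-partialMatching s =
    greedy-matching {P = λ v → side v ≡ s} (side-noIndependentTriple s) _
      (Unique.filter⁺ (λ v → side v ≟ s) (allFin⁺ n)) (all-filter (λ v → side v ≟ s) (allFin n))

proposition4p6 : ∀ (n : ℕ) (G : Graph n) → NicheRealizable G →
                   ∃[ M ] (IsMatching G M × n ≤ 2 * length M + 4)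
proposition4p6 n G (D , bt , niche) = large-matching 4 m four-unmatched
  where
  open IsBipartiteTournament bt using (side)
  open PartialMatching
  X = side-partialMatching {G = G} bt niche true
  Y = side-partialMatching {G = G} bt niche false

  m : PartialMatching G (allFin n)
  m = PartialMatching-resp-↭ (filter-bool-↭ side (allFin n)) (proj₁ X ++ᴹ proj₁ Y)

  four-unmatched : length (unmatched m) ≤ 4
  four-unmatched = ≤-trans (≤-reflexive (length-++ (unmatched (proj₁ X)))) (+-mono-≤ (proj₂ X) (proj₂ Y))
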